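{- For any LF context, kind, canonical type or canonical term $E$ and any substitution $\theta$, it is decidable whether there is an $E'$ such that $\theta(E)\rightsquigarrow E'$ is derivable, and there is at most one such $E'$. Similarly, for any atomic term $R$ and substitution $\theta$, it is decidable whether there is an atomic term $R'$, or a canonical term $M'$ and arity type $\alpha'$, such that $\theta(R)\rightsquigarrow_r R'$, respectively $\theta(R)\rightsquigarrow_r M':\alpha'$, is derivable; at most one of these two judgement forms is derivable, and it is derivable for at most one $R'$, respectively at most one pair $M',\alpha'$.
   Context: Canonical LF syntax: kinds $K ::= \mathrm{Type}\mid \Pi x{:}A.K$; canonical types $A ::= P \mid \Pi x{:}A_1.A_2$; atomic types $P ::= a\mid P\,M$; canonical terms $M ::= R\mid \lambda x.M$; atomic terms $R ::= c\mid x\mid R\,M$; contexts $\Gamma ::= \cdot \mid \Gamma,x{:}A$. Here $c$ ranges over term constants, $a$ over type constants, $x$ over variables; expressions are identified up to renaming of bound variables. Arity types are given by $\alpha ::= o\mid \alpha\to\alpha$. A substitution $\theta$ is a finite set $\{\langle x_1,M_1,\alpha_1\rangle,\dots,\langle x_n,M_n,\alpha_n\rangle\}$ with $x_i$ distinct variables, $M_i$ canonical terms and $\alpha_i$ arity types; $\mathrm{dom}(\theta)=\{x_1,\dots,x_n\}$, $\mathrm{rng}(\theta)=\{M_1,\dots,M_n\}$. "$x$ not free in $\mathrm{dom}(\theta)\cup\mathrm{rng}(\theta)$" means $x\notin\mathrm{dom}(\theta)$ and $x$ is not free in any $M_i$. Hereditary substitution is given by the judgements $\theta(M)\rightsquigarrow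 M'$, $\theta(R)\rightsquigarrow_r R'$ and $\theta(R)\rightsquigarrow_r M':\alpha'$, defined inductively by: (i) if $\theta(R)\rightsquigarrow_r R'$ then $\theta(R)\rightsquigarrow R'$; if $\theta(R)\rightsquigarrow_r M':\alpha'$ then $\theta(R)\rightsquigarrow M'$; $\theta(\lambda x.M)\rightsquigarrow \lambda x.M'$ if $x$ is not free in $\mathrm{dom}(\theta)\cup\mathrm{rng}(\theta)$ and $\theta(M)\rightsquigarrow M'$. (ii) $\theta(x)\rightsquigarrow_r M:\alpha$ if $\langle x,M,\alpha\rangle\in\theta$; $\theta(R\,M)\rightsquigarrow_r M''':\alpha''$ if $\theta(R)\rightsquigarrow_r \lambda x.M':\alpha'\to\alpha''$, $\theta(M)\rightsquigarrow M''$ and $\{\langle x,M'',\alpha'\rangle\}(M')\rightsquigarrow M'''$. (iii) $\theta(c)\rightsquigarrow_r c$; $\theta(x)\rightsquigarrow_r x$ if $x\notin\mathrm{dom}(\theta)$; $\theta(R\,M)\rightsquigarrow_r R'\,M'$ if $\theta(R)\rightsquigarrow_r R'$ and $\theta(M)\rightsquigarrow M'$. On types: $\theta(a)\rightsquigarrow a$; $\theta(P\,M)\rightsquigarrow P'\,M'$ if $\theta(P)\rightsquigarrow P'$ and $\theta(M)\rightsquigarrow M'$; $\theta(\Pi x{:}A_1.A_2)\rightsquigarrow \Pi x{:}A_1'.A_2'$ if $x$ is not free in $\mathrm{dom}(\theta)\cup\mathrm{rng}(\theta)$, $\theta(A_1)\rightsquigarrow A_1'$ and $\theta(A_2)\rightsquigarrow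 A_2'$. On kinds analogously, with $\theta(\mathrm{Type})\rightsquigarrow\mathrm{Type}$. On contexts: $\theta(\cdot)\rightsquigarrow\cdot$, and $\theta(\Gamma,x{:}A)\rightsquigarrow \Gamma',x{:}A'$ if $x$ is not free in $\mathrm{dom}(\theta)\cup\mathrm{rng}(\theta)$, $\theta(\Gamma)\rightsquigarrow\Gamma'$ and $\theta(A)\rightsquigarrow A'$. -}

module Defs where

-- Canonical LF syntax with de Bruijn indices (so that syntactic equality
-- ≡ is exactly identity up to renaming of bound variables), hereditary
-- substitution as inductive judgements, following the paper's rules.

open import Data.Nat using (ℕ; zero; suc; _<ᵇ_)
open import Data.Bool using (if_then_else_)
open import Data.Product using (_×_; _,_; ∃; ∃₂)
open import Data.List using (List; []; _∷_; map)
open import Data.List.Membership.Propositional using (_∈_; _∉_)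
open import Data.List.Relation.Unary.Unique.Propositional using (Unique)
open import Relation.Nullary using (Dec; ¬_)
open import Relation.Binary.PropositionalEquality using (_≡_)

Const : Set
Const = ℕ

data Arity : Set where
  o   : Arity
  _⇒_ : Arity → Arity → Arity

mutual
  data Can : Set where
    rt  : Atm → Can
    lam : Can → Can

  data Atm : Set where
    con : Const → Atm
    var : ℕ → Atm
    app : Atm → Can → Atm

data ATy : Set where
  tcon : Const → ATy
  tapp : ATy → Can → ATy

data Ty : Set where
  atm : ATy → Ty
  pi  : Ty → Ty → Ty         -- Π x:A1.A2, x bound (index 0) in A2

data Kind : Set where
  type : Kind
  kpi  : Ty → Kind → Kind

-- contexts Γ ::= · | Γ, x:A  (A is in the scope of the variables of Γ)
data Ctx : Set where
  ∙   : Ctx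
  _,,_ : Ctx → Ty → Ctx

ctxLength : Ctx → ℕ
ctxLength ∙ = 0
ctxLength (Γ ,, _) = suc (ctxLength Γ)

mutual
  shiftC : ℕ → Can → Can
  shiftC c (rt R)  = rt (shiftR c R)
  shiftC c (lam M) = lam (shiftC (suc c) M)

  shiftR : ℕ → Atm → Atm
  shiftR c (con k)   = con k
  shiftR c (var n)   = if n <ᵇ c then var n else var (suc n)
  shiftR c (app R M) = app (shiftR c R) (shiftC c M)

-- substitutions: finite sets of triples ⟨x, M, α⟩ (represented as lists;
-- distinctness of the x_i is imposed by DistinctDom)
Subst : Set
Subst = List (ℕ × Can × Arity)

dom : Subst → List ℕ
dom = map (λ { (x , _ , _) → x })

DistinctDom : Subst → Set
DistinctDom θ = Unique (dom θ)

-- moving θ under one binder (the de Bruijn rendering of choosing the bound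
-- variable not free in dom(θ) ∪ rng(θ))
↑ : Subst → Subst
↑ = map (λ { (x , M , α) → (suc x , shiftC 0 M , α) })

↑^ : ℕ → Subst → Subst
↑^ zero θ = θ
↑^ (suc n) θ = ↑ (↑^ n θ)

-- hereditary substitution judgements
--   θ(M) ⇝ M'  : SubC θ M M'
--   θ(R) ⇝r R' : SubR θ R R'
--   θ(R) ⇝r M' : α' : SubRA θ R M' α'
mutual
  data SubC (θ : Subst) : Can → Can → Set where
    c-atm  : ∀ {R R'} → SubR θ R R' → SubC θ (rt R) (rt R')
    c-atmH : ∀ {R M' α'} → SubRA θ R M' α' → SubC θ (rt R) M'
    c-lam  : ∀ {M M'} → SubC (↑ θ) M M' → SubC θ (lam M) (lam M')

  data SubRA (θ : Subst) : Atm → Can → Arity → Set where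
    ra-var : ∀ {x M α} → (x , M , α) ∈ θ → SubRA θ (var x) M α
    -- In de Bruijn form the body M' lives under
    -- one binder: we substitute the shifted M'' for index 0, obtaining M₀ in
    -- the body's scope, and M''' is M₀ viewed in the outer scope
    -- (i.e. shiftC 0 M''' ≡ M₀).
    ra-app : ∀ {R M M' M'' M₀ M''' α' α''} →
             SubRA θ R (lam M') (α' ⇒ α'') →
             SubC θ M M'' →
             SubC ((0 , shiftC 0 M'' , α') ∷ []) M' M₀ →
             shiftC 0 M''' ≡ M₀ →
             SubRA θ (app R M) M''' α''

  data SubR (θ : Subst) : Atm → Atm → Set where
    r-con : ∀ {k} → SubR θ (con k) (con k)
    r-var : ∀ {x} → x ∉ dom θ → SubR θ (var x) (var x)
    r-app : ∀ {R R' M M'} → SubR θ R R' → SubC θ M M' →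
            SubR θ (app R M) (app R' M')

data SubP (θ : Subst) : ATy → ATy → Set where
  p-con : ∀ {a} → SubP θ (tcon a) (tcon a)
  p-app : ∀ {P P' M M'} → SubP θ P P' → SubC θ M M' →
          SubP θ (tapp P M) (tapp P' M')

data SubT (θ : Subst) : Ty → Ty → Set where
  t-atm : ∀ {P P'} → SubP θ P P' → SubT θ (atm P) (atm P')
  t-pi  : ∀ {A₁ A₁' A₂ A₂'} → SubT θ A₁ A₁' → SubT (↑ θ) A₂ A₂' →
          SubT θ (pi A₁ A₂) (pi A₁' A₂')

data SubK (θ : Subst) : Kind → Kind → Set where
  k-type : SubK θ type type
  k-pi   : ∀ {A A' K K'} → SubT θ A A' → SubK (↑ θ) K K' →
           SubK θ (kpi A K) (kpi A' K')

data SubΓ (θ : Subst) : Ctx → Ctx → Set where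
  g-nil  : SubΓ θ ∙ ∙
  g-cons : ∀ {Γ Γ' A A'} → SubΓ θ Γ Γ' → SubT (↑^ (ctxLength Γ) θ) A A' →
           SubΓ θ (Γ ,, A) (Γ' ,, A')

DecUnique : {E : Set} → (E → Set) → Set
DecUnique {E} P = Dec (∃ P) × (∀ (E₁ E₂ : E) → P E₁ → P E₂ → E₁ ≡ E₂)

AtomicDecUnique : Subst → Atm → Set
AtomicDecUnique θ R =
  Dec (∃ λ R' → SubR θ R R') ×
  Dec (∃₂ λ M' α' → SubRA θ R M' α') ×
  (¬ ((∃ λ R' → SubR θ R R') × (∃₂ λ M' α' → SubRA θ R M' α'))) ×
  (∀ R₁ R₂ → SubR θ R R₁ → SubR θ R R₂ → R₁ ≡ R₂) ×
  (∀ M₁ α₁ M₂ α₂ → SubRA θ R M₁ α₁ → SubRA θ R M₂ α₂ →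
     (M₁ ≡ M₂ × α₁ ≡ α₂))

-- The judgements are syntax-directed except for the premise of ra-app that
-- substitutes into the body of θ(R), which is not a subterm of the input.
-- That premise substitutes a single variable of arity α', where θ(R) has
-- arity α' ⇒ α''.  The arity produced by θ(R) ⇝r M' : α' is always a
-- subexpression of an arity stored in θ, so the proof is a lexicographic
-- induction: on a bound for the arities in θ, and inside it on the term.
-- With de Bruijn indices the result of ra-app is the unshifting of the
-- substituted body, so we also need that shifting is injective and has
-- decidable image.

module Submission where

open import Defs
open import Data.Product using (_×_; _,_; proj₁; proj₂; ∃; ∃₂)
open import Data.Nat using (ℕ; zero; suc; _<ᵇ_; _+_; _⊔_; _≤_; _<_; s≤s)
open import Data.Nat.Properties using (_≟_; suc-injective; ≤-trans; m≤m+n; m≤n+m; n≤1+n; m≤m⊔n; m≤n⊔m)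
open import Data.Bool using (true; false)
open import Data.List using ([]; _∷_; map)
open import Data.List.Relation.Unary.Any using (here; there)
open import Data.List.Relation.Unary.All using ([]; _∷_; lookup)
open import Data.List.Relation.Unary.AllPairs using ([]; _∷_)
open import Data.List.Relation.Unary.Unique.Propositional using (Unique)
open import Data.List.Relation.Unary.Unique.Propositional.Properties using (map⁺)
open import Data.List.Membership.Propositional using (_∈_)
open import Data.List.Membership.Propositional.Properties using (∈-map⁺; ∈-map⁻)
open import Data.List.Membership.DecPropositional _≟_ using (_∈?_)
open import Relation.Nullary using (Dec; yes; no; ¬_; contradiction)
open import Relation.Nullary.Decidable using (map′; _×-dec_; ¬?)
open import Relation.Binary.PropositionalEquality using (_≡_; _≢_; refl; sym; trans; cong; cong₂; subst)

module _ {A C : Set} {P : A → Set} {S : C → Set} (f : A → C) where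

  DecUnique-map : (∀ {a} → P a → S (f a)) → (∀ {c} → S c → ∃ λ a → P a × c ≡ f a) →
                  DecUnique P → DecUnique S
  DecUnique-map intro inv (P? , P!) = S? , S!
    where
    S? : Dec (∃ S)
    S? = map′ (λ (a , p) → f a , intro p) (λ (_ , s) → let (a , p , _) = inv s in a , p) P?
    S! : ∀ c₁ c₂ → S c₁ → S c₂ → c₁ ≡ c₂
    S! _ _ s₁ s₂ with inv s₁ | inv s₂
    ... | _ , p₁ , refl | _ , p₂ , refl = cong f (P! _ _ p₁ p₂)

module _ {A B C : Set} {P : A → Set} {Q : B → Set} {S : C → Set} (f : A → B → C) where

  DecUnique-map₂ : (∀ {a b} → P a → Q b → S (f a b)) →
                   (∀ {c} → S c → ∃₂ λ a b → P a × Q b × c ≡ f a b) →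
                   DecUnique P → DecUnique Q → DecUnique S
  DecUnique-map₂ intro inv (P? , P!) (Q? , Q!) = S? , S!
    where
    S? : Dec (∃ S)
    S? = map′ (λ ((a , p) , (b , q)) → f a b , intro p q)
              (λ (_ , s) → let (a , b , p , q , _) = inv s in (a , p) , (b , q))
              (P? ×-dec Q?)
    S! : ∀ c₁ c₂ → S c₁ → S c₂ → c₁ ≡ c₂
    S! _ _ s₁ s₂ with inv s₁ | inv s₂
    ... | _ , _ , p₁ , q₁ , refl | _ , _ , p₂ , q₂ , refl = cong₂ f (P! _ _ p₁ p₂) (Q! _ _ q₁ q₂)

-- shiftR c acts on indices by shiftIdx c, which skips exactly c.
shiftIdx : ℕ → ℕ → ℕ
shiftIdx zero    m       = suc m
shiftIdx (suc c) zero    = zero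
shiftIdx (suc c) (suc m) = suc (shiftIdx c m)

var-injective : ∀ {m n} → var m ≡ var n → m ≡ n
var-injective refl = refl

shiftR-var : ∀ c m → shiftR c (var m) ≡ var (shiftIdx c m)
shiftR-var zero    m       = refl
shiftR-var (suc c) zero    = refl
shiftR-var (suc c) (suc m) with m <ᵇ c | shiftR-var c m
... | true  | e = cong (λ k → var (suc k)) (var-injective e)
... | false | e = cong (λ k → var (suc k)) (var-injective e)

shiftIdx-injective : ∀ c {m m'} → shiftIdx c m ≡ shiftIdx c m' → m ≡ m'
shiftIdx-injective zero    e = suc-injective e
shiftIdx-injective (suc c) {zero}  {zero}   e = refl
shiftIdx-injective (suc c) {suc m} {suc m'} e = cong suc (shiftIdx-injective c (suc-injective e))

shiftIdx-≢ : ∀ c m → shiftIdx c m ≢ c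
shiftIdx-≢ (suc c) (suc m) e = shiftIdx-≢ c m (suc-injective e)

shiftIdx-onto : ∀ c {n} → n ≢ c → ∃ λ m → shiftIdx c m ≡ n
shiftIdx-onto zero    {zero}  n≢c = contradiction refl n≢c
shiftIdx-onto zero    {suc n} _   = n , refl
shiftIdx-onto (suc c) {zero}  _   = zero , refl
shiftIdx-onto (suc c) {suc n} n≢c =
  let (m , e) = shiftIdx-onto c (λ n≡c → n≢c (cong suc n≡c)) in suc m , cong suc e

shiftR≡var⇒var : ∀ c X {n} → shiftR c X ≡ var n → ∃ λ m → X ≡ var m × shiftIdx c m ≡ n
shiftR≡var⇒var c (var m) e = m , refl , var-injective (trans (sym (shiftR-var c m)) e)

rt-injective : ∀ {R R'} → rt R ≡ rt R' → R ≡ R'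
rt-injective refl = refl

lam-injective : ∀ {M M'} → lam M ≡ lam M' → M ≡ M'
lam-injective refl = refl

app-injective : ∀ {R R' M M'} → app R M ≡ app R' M' → R ≡ R' × M ≡ M'
app-injective refl = refl , refl

mutual
  shiftC-injective : ∀ c X Y → shiftC c X ≡ shiftC c Y → X ≡ Y
  shiftC-injective c (rt R)  (rt R')  e = cong rt (shiftR-injective c R R' (rt-injective e))
  shiftC-injective c (lam M) (lam M') e = cong lam (shiftC-injective (suc c) M M' (lam-injective e))

  shiftR-injective : ∀ c X Y → shiftR c X ≡ shiftR c Y → X ≡ Y
  shiftR-injective c (var m) Y e with shiftR≡var⇒var c Y (trans (sym e) (shiftR-var c m))
  ... | _ , refl , e' = cong var (sym (shiftIdx-injective c e'))
  shiftR-injective c X (var m) e with shiftR≡var⇒var c X (trans e (shiftR-var c m))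
  ... | _ , refl , e' = cong var (shiftIdx-injective c e')
  shiftR-injective c (con k) (con .k) refl = refl
  shiftR-injective c (app R M) (app R' M') e =
    let (e₁ , e₂) = app-injective e in cong₂ app (shiftR-injective c R R' e₁) (shiftC-injective c M M' e₂)

shiftC-preimage? : ∀ c Y → Dec (∃ λ X → shiftC c X ≡ Y)
shiftR-preimage? : ∀ c Y → Dec (∃ λ X → shiftR c X ≡ Y)

shiftC-preimage? c (rt R) =
  map′ (λ (X , e) → rt X , cong rt e) (λ { (rt X , e) → X , rt-injective e }) (shiftR-preimage? c R)
shiftC-preimage? c (lam M) =
  map′ (λ (X , e) → lam X , cong lam e) (λ { (lam X , e) → X , lam-injective e }) (shiftC-preimage? (suc c) M)

shiftR-preimage? c (con k) = yes (con k , refl)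
shiftR-preimage? c (var n) with n ≟ c
... | yes refl = no λ (X , e) → let (m , _ , e') = shiftR≡var⇒var c X e in shiftIdx-≢ c m e'
... | no n≢c   = let (m , e) = shiftIdx-onto c n≢c in yes (var m , trans (shiftR-var c m) (cong var e))
shiftR-preimage? c (app R M) = map′ (λ ((X , e₁) , (Y , e₂)) → app X Y , cong₂ app e₁ e₂) inv
  (shiftR-preimage? c R ×-dec shiftC-preimage? c M)
  where
  inv : ∃ (λ X → shiftR c X ≡ app R M) → ∃ (λ X → shiftR c X ≡ R) × ∃ (λ Y → shiftC c Y ≡ M)
  inv (app X Y , e) = let (e₁ , e₂) = app-injective e in (X , e₁) , (Y , e₂)
  inv (var m , e) = contradiction (trans (sym (shiftR-var c m)) e) λ ()

dom-↑ : ∀ θ → dom (↑ θ) ≡ map suc (dom θ)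
dom-↑ []      = refl
dom-↑ (_ ∷ θ) = cong (_ ∷_) (dom-↑ θ)

↑-distinct : ∀ {θ} → DistinctDom θ → DistinctDom (↑ θ)
↑-distinct {θ} d = subst Unique (sym (dom-↑ θ)) (map⁺ suc-injective d)

↑^-distinct : ∀ k {θ} → DistinctDom θ → DistinctDom (↑^ k θ)
↑^-distinct zero    d = d
↑^-distinct (suc k) d = ↑-distinct (↑^-distinct k d)

∈⇒∈dom : ∀ {θ x M α} → (x , M , α) ∈ θ → x ∈ dom θ
∈⇒∈dom = ∈-map⁺ _

lookup? : ∀ θ x → Dec (∃₂ λ M α → (x , M , α) ∈ θ)
lookup? θ x = map′ found (λ (_ , _ , m) → ∈⇒∈dom m) (x ∈? dom θ)
  where
  found : x ∈ dom θ → ∃₂ λ M α → (x , M , α) ∈ θ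
  found x∈ with ∈-map⁻ _ x∈
  ... | (_ , M , α) , m , refl = M , α , m

distinct-lookup : ∀ {θ} → DistinctDom θ → ∀ {x M₁ α₁ M₂ α₂} →
                  (x , M₁ , α₁) ∈ θ → (x , M₂ , α₂) ∈ θ → M₁ ≡ M₂ × α₁ ≡ α₂
distinct-lookup (_ ∷ _) (here refl) (here refl) = refl , refl
distinct-lookup (x≢ ∷ _) (here refl) (there m)   = contradiction refl (lookup x≢ (∈⇒∈dom m))
distinct-lookup (x≢ ∷ _) (there m)   (here refl) = contradiction refl (lookup x≢ (∈⇒∈dom m))
distinct-lookup (_ ∷ d) (there m₁)  (there m₂)  = distinct-lookup d m₁ m₂

size : Arity → ℕ
size o       = 0
size (α ⇒ β) = suc (size α + size β)

ArityBound : ℕ → Subst → Set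
ArityBound n θ = ∀ {x M α} → (x , M , α) ∈ θ → size α ≤ n

↑-ArityBound : ∀ {n θ} → ArityBound n θ → ArityBound n (↑ θ)
↑-ArityBound b m with ∈-map⁻ _ m
... | _ , m' , refl = b m'

maxSize : Subst → ℕ
maxSize []              = 0
maxSize ((_ , _ , α) ∷ θ) = size α ⊔ maxSize θ

maxSize-bound : ∀ θ → ArityBound (maxSize θ) θ
maxSize-bound ((_ , _ , α) ∷ θ) (here refl) = m≤m⊔n (size α) (maxSize θ)
maxSize-bound ((_ , _ , α) ∷ θ) (there m)   = ≤-trans (maxSize-bound θ m) (m≤n⊔m (size α) (maxSize θ))

SubRA-ArityBound : ∀ {n θ R M α} → ArityBound n θ → SubRA θ R M α → size α ≤ n
SubRA-ArityBound b (ra-var m) = b m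
SubRA-ArityBound b (ra-app {α' = α'} {α''} q _ _ _) =
  ≤-trans (≤-trans (m≤n+m (size α'') (size α')) (n≤1+n _)) (SubRA-ArityBound b q)

size-dom< : ∀ α β → size α < size (α ⇒ β)
size-dom< α β = s≤s (m≤m+n (size α) (size β))

decUnique-rt : ∀ {θ R} → AtomicDecUnique θ R → DecUnique (SubC θ (rt R))
decUnique-rt {θ} {R} (R? , RA? , R⊥RA , R! , RA!) = rt? R? RA? , rt!
  where
  rt? : Dec (∃ (SubR θ R)) → Dec (∃₂ (SubRA θ R)) → Dec (∃ (SubC θ (rt R)))
  rt? (yes (R' , p)) _                  = yes (rt R' , c-atm p)
  rt? (no ¬p)        (yes (M' , _ , q)) = yes (M' , c-atmH q)
  rt? (no ¬p)        (no ¬q)            =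
    no λ { (_ , c-atm p) → ¬p (_ , p) ; (_ , c-atmH q) → ¬q (_ , _ , q) }
  rt! : ∀ M₁ M₂ → SubC θ (rt R) M₁ → SubC θ (rt R) M₂ → M₁ ≡ M₂
  rt! _ _ (c-atm p₁)  (c-atm p₂)  = cong rt (R! _ _ p₁ p₂)
  rt! _ _ (c-atm p₁)  (c-atmH q₂) = contradiction ((_ , p₁) , (_ , _ , q₂)) R⊥RA
  rt! _ _ (c-atmH q₁) (c-atm p₂)  = contradiction ((_ , p₂) , (_ , _ , q₁)) R⊥RA
  rt! _ _ (c-atmH q₁) (c-atmH q₂) = proj₁ (RA! _ _ _ _ q₁ q₂)

decUnique-lam : ∀ {θ M} → DecUnique (SubC (↑ θ) M) → DecUnique (SubC θ (lam M))
decUnique-lam = DecUnique-map lam c-lam λ { (c-lam p) → _ , p , refl }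

atomicDecUnique-con : ∀ {θ} k → AtomicDecUnique θ (con k)
atomicDecUnique-con k =
  yes (con k , r-con) , no (λ { (_ , _ , ()) }) , (λ { (_ , _ , _ , ()) }) ,
  (λ { _ _ r-con r-con → refl }) , (λ { _ _ _ _ () })

atomicDecUnique-var : ∀ {θ} → DistinctDom θ → ∀ x → AtomicDecUnique θ (var x)
atomicDecUnique-var {θ} d x = R? , RA? , R⊥RA , (λ { _ _ (r-var _) (r-var _) → refl }) , RA!
  where
  R? : Dec (∃ (SubR θ (var x)))
  R? = map′ (λ x∉ → var x , r-var x∉) (λ { (_ , r-var x∉) → x∉ }) (¬? (x ∈? dom θ))
  RA? : Dec (∃₂ (SubRA θ (var x)))
  RA? = map′ (λ (M , α , m) → M , α , ra-var m) (λ { (M , α , ra-var m) → M , α , m }) (lookup? θ x)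
  R⊥RA : ¬ (∃ (SubR θ (var x)) × ∃₂ (SubRA θ (var x)))
  R⊥RA ((_ , r-var x∉) , (_ , _ , ra-var m)) = x∉ (∈⇒∈dom m)
  RA! : ∀ M₁ α₁ M₂ α₂ → SubRA θ (var x) M₁ α₁ → SubRA θ (var x) M₂ α₂ → M₁ ≡ M₂ × α₁ ≡ α₂
  RA! _ _ _ _ (ra-var m₁) (ra-var m₂) = distinct-lookup d m₁ m₂

SingletonDecUnique : ℕ → Set
SingletonDecUnique n = ∀ N α → size α < n → ∀ M → DecUnique (SubC ((0 , N , α) ∷ []) M)

module ByAritySize (n : ℕ) (ih : SingletonDecUnique n) where

  atomicDecUnique-app : ∀ {θ R M} → ArityBound n θ → AtomicDecUnique θ R → DecUnique (SubC θ M) →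
                        AtomicDecUnique θ (app R M)
  atomicDecUnique-app {θ} {R} {M} b (R? , RA? , R⊥RA , R! , RA!) (M? , M!) =
    proj₁ app-dec , app? RA? M? , app-R⊥RA , proj₂ app-dec , app!
    where
    app-dec : DecUnique (SubR θ (app R M))
    app-dec = DecUnique-map₂ app r-app (λ { (r-app p q) → _ , _ , p , q , refl }) (R? , R!) (M? , M!)

    app-R⊥RA : ¬ (∃ (SubR θ (app R M)) × ∃₂ (SubRA θ (app R M)))
    app-R⊥RA ((_ , r-app p _) , (_ , _ , ra-app q _ _ _)) = R⊥RA ((_ , p) , (_ , _ , q))

    body : ∀ {B α β} N → SubRA θ R (lam B) (α ⇒ β) → DecUnique (SubC ((0 , shiftC 0 N , α) ∷ []) B)
    body N q = ih (shiftC 0 N) _ (≤-trans (size-dom< _ _) (SubRA-ArityBound b q)) _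

    ra-app-inv : ∀ {B α β N X γ} → SubRA θ R (lam B) (α ⇒ β) → SubC θ M N → SubRA θ (app R M) X γ →
                 SubC ((0 , shiftC 0 N , α) ∷ []) B (shiftC 0 X) × γ ≡ β
    ra-app-inv q c (ra-app q' c' s refl) with RA! _ _ _ _ q q' | M! _ _ c c'
    ... | refl , refl | refl = s , refl

    app! : ∀ M₁ α₁ M₂ α₂ → SubRA θ (app R M) M₁ α₁ → SubRA θ (app R M) M₂ α₂ → M₁ ≡ M₂ × α₁ ≡ α₂
    app! _ _ _ _ d₁@(ra-app q c _ _) d₂ with ra-app-inv q c d₁ | ra-app-inv q c d₂
    ... | s₁ , refl | s₂ , refl = shiftC-injective 0 _ _ (proj₂ (body _ q) _ _ s₁ s₂) , refl

    app? : Dec (∃₂ (SubRA θ R)) → Dec (∃ (SubC θ M)) → Dec (∃₂ (SubRA θ (app R M)))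
    app? (no ¬q) _ = no λ { (_ , _ , ra-app q _ _ _) → ¬q (_ , _ , q) }
    app? (yes (rt _ , _ , q)) _ =
      no λ { (_ , _ , ra-app q' _ _ _) → contradiction (proj₁ (RA! _ _ _ _ q q')) λ () }
    app? (yes (lam _ , o , q)) _ =
      no λ { (_ , _ , ra-app q' _ _ _) → contradiction (proj₂ (RA! _ _ _ _ q q')) λ () }
    app? (yes (lam B , α ⇒ β , q)) (no ¬c) = no λ { (_ , _ , ra-app _ c _ _) → ¬c (_ , c) }
    app? (yes (lam B , α ⇒ β , q)) (yes (N , c)) with proj₁ (body N q)
    ... | no ¬s = no λ (_ , _ , d) → ¬s (_ , proj₁ (ra-app-inv q c d))
    ... | yes (M₀ , s) with shiftC-preimage? 0 M₀
    ...   | yes (X , refl) = yes (X , β , ra-app q c s refl)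
    ...   | no ¬X = no λ (X , _ , d) → ¬X (X , proj₂ (body N q) _ _ (proj₁ (ra-app-inv q c d)) s)

  mutual
    SubC-decUnique : ∀ {θ} → ArityBound n θ → DistinctDom θ → ∀ M → DecUnique (SubC θ M)
    SubC-decUnique b d (rt R)  = decUnique-rt (SubR-atomicDecUnique b d R)
    SubC-decUnique b d (lam M) = decUnique-lam (SubC-decUnique (↑-ArityBound b) (↑-distinct d) M)

    SubR-atomicDecUnique : ∀ {θ} → ArityBound n θ → DistinctDom θ → ∀ R → AtomicDecUnique θ R
    SubR-atomicDecUnique b d (con k)   = atomicDecUnique-con k
    SubR-atomicDecUnique b d (var x)   = atomicDecUnique-var d x
    SubR-atomicDecUnique b d (app R M) =
      atomicDecUnique-app b (SubR-atomicDecUnique b d R) (SubC-decUnique b d M)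

singletonDecUnique : ∀ n → SingletonDecUnique n
singletonDecUnique (suc n) N α (s≤s α≤n) =
  ByAritySize.SubC-decUnique n (singletonDecUnique n) bound ([] ∷ [])
  where
  bound : ArityBound n ((0 , N , α) ∷ [])
  bound (here refl) = α≤n

SubC-decUnique : ∀ θ → DistinctDom θ → ∀ M → DecUnique (SubC θ M)
SubC-decUnique θ = ByAritySize.SubC-decUnique (maxSize θ) (singletonDecUnique _) (maxSize-bound θ)

SubR-atomicDecUnique : ∀ θ → DistinctDom θ → ∀ R → AtomicDecUnique θ R
SubR-atomicDecUnique θ = ByAritySize.SubR-atomicDecUnique (maxSize θ) (singletonDecUnique _) (maxSize-bound θ)

SubP-decUnique : ∀ θ → DistinctDom θ → ∀ P → DecUnique (SubP θ P)
SubP-decUnique θ d (tcon a)   = yes (tcon a , p-con) , λ { _ _ p-con p-con → refl }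
SubP-decUnique θ d (tapp P M) =
  DecUnique-map₂ tapp p-app (λ { (p-app p q) → _ , _ , p , q , refl })
    (SubP-decUnique θ d P) (SubC-decUnique θ d M)

SubT-decUnique : ∀ θ → DistinctDom θ → ∀ A → DecUnique (SubT θ A)
SubT-decUnique θ d (atm P)    =
  DecUnique-map atm t-atm (λ { (t-atm p) → _ , p , refl }) (SubP-decUnique θ d P)
SubT-decUnique θ d (pi A₁ A₂) =
  DecUnique-map₂ pi t-pi (λ { (t-pi p q) → _ , _ , p , q , refl })
    (SubT-decUnique θ d A₁) (SubT-decUnique (↑ θ) (↑-distinct d) A₂)

SubK-decUnique : ∀ θ → DistinctDom θ → ∀ K → DecUnique (SubK θ K)
SubK-decUnique θ d type      = yes (type , k-type) , λ { _ _ k-type k-type → refl }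
SubK-decUnique θ d (kpi A K) =
  DecUnique-map₂ kpi k-pi (λ { (k-pi p q) → _ , _ , p , q , refl })
    (SubT-decUnique θ d A) (SubK-decUnique (↑ θ) (↑-distinct d) K)

SubΓ-decUnique : ∀ θ → DistinctDom θ → ∀ Γ → DecUnique (SubΓ θ Γ)
SubΓ-decUnique θ d ∙        = yes (∙ , g-nil) , λ { _ _ g-nil g-nil → refl }
SubΓ-decUnique θ d (Γ ,, A) =
  DecUnique-map₂ _,,_ g-cons (λ { (g-cons p q) → _ , _ , p , q , refl })
    (SubΓ-decUnique θ d Γ) (SubT-decUnique _ (↑^-distinct (ctxLength Γ) d) A)

theorem2p1 : (θ : Subst) → DistinctDom θ →
    ((Γ : Ctx) → DecUnique (SubΓ θ Γ)) ×
    ((K : Kind) → DecUnique (SubK θ K)) ×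
    ((A : Ty) → DecUnique (SubT θ A)) ×
    ((M : Can) → DecUnique (SubC θ M)) ×
    ((R : Atm) → AtomicDecUnique θ R)
theorem2p1 θ d =
  SubΓ-decUnique θ d , SubK-decUnique θ d , SubT-decUnique θ d , SubC-decUnique θ d , SubR-atomicDecUnique θ d
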